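{- Let $\pi$ be minus-decomposable, $\pi=\sigma\ominus\rho$, where $\sigma$ is $k$-pass sortable and $\rho$ is $m$-pass sortable (with $k=t(\sigma)+1$, $m=t(\rho)+1$). If the last entry of $\sigma$ is not $1$, then $\pi$ is $(k+m)$-pass sortable and $t(\pi)=t(\sigma)+t(\rho)+1$; if the last entry of $\sigma$ is $1$, then $\pi$ is $(k+m-1)$-pass sortable and $t(\pi)=t(\sigma)+t(\rho)$.
   Context: For permutations $\sigma$ of length $a$ and $\rho$ of length $b$, $\sigma\ominus\rho$ is the permutation of length $a+b$ obtained by concatenating the sequence $\sigma$ with every entry increased by $b$, followed by $\rho$; $\pi$ is minus-decomposable if $\pi=\sigma\ominus\rho$ for nonempty $\sigma,\rho$. Multi-pass stack sorting: in a pass, the entries of the current input are pushed one at a time, in order, onto a stack; whenever the top of the stack is the smallest value not yet output, it is popped to the output (repeatedly); entries are never popped otherwise. When all input entries have been pushed and no pop is possible, if the stack is nonempty the remaining entries are returned to the input in their original relative order and a new pass begins. A permutation is $k$-pass sortable if it is sorted within $k$ passes; the tier $t(\pi)$ is one less than the minimum number of passes needed to output $1,\dots,n$. -}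

module Defs where

open import Data.Nat using (ℕ; zero; suc; _+_; _<_; _≡ᵇ_)
open import Data.Bool using (if_then_else_)
open import Data.List using (List; []; _∷_; _++_; map; length; upTo; reverse)
open import Data.Product using (_×_; _,_; proj₂)
open import Data.List.Relation.Binary.Permutation.Propositional using (_↭_)
open import Relation.Binary.PropositionalEquality using (_≡_)
open import Relation.Nullary using (¬_)

IsPerm : List ℕ → Set
IsPerm π = π ↭ map suc (upTo (length π))

_⊖_ : List ℕ → List ℕ → List ℕ
σ ⊖ ρ = map (_+ length ρ) σ ++ ρ

-- popping: while the top of the stack equals the smallest value not yet
-- output (tracked as `next`, since the output is always 1,2,...,next-1), pop it.
popAll : ℕ → List ℕ → ℕ × List ℕ
popAll next []       = next , []
popAll next (s ∷ st) = if s ≡ᵇ next then popAll (suc next) st else (next , s ∷ st)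

-- push the input entries one at a time (stack head = top), popping after each push
pushAll : ℕ → List ℕ → List ℕ → ℕ × List ℕ
pushAll next []       st = next , st
pushAll next (x ∷ xs) st with popAll next (x ∷ st)
... | next' , st' = pushAll next' xs st'

-- one pass: state = (smallest value not yet output , current input).
-- Entries left on the stack are returned to the input in their original
-- relative order, i.e. bottom-to-top order of the stack = reverse of the list.
onePass : ℕ × List ℕ → ℕ × List ℕ
onePass (next , input) with pushAll next input []
... | next' , st = next' , reverse st

passes : ℕ → ℕ × List ℕ → ℕ × List ℕ
passes zero    s = s
passes (suc k) s = passes k (onePass s)

KPassSortable : ℕ → List ℕ → Set
KPassSortable k π = proj₂ (passes k (1 , π)) ≡ []

Tier : List ℕ → ℕ → Set
Tier π t = KPassSortable (suc t) π × (∀ j → j < suc t → ¬ KPassSortable j π)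

module Submission where

-- Write σ ⊖ ρ as σ′ ++ ρ, where σ′ is σ with every entry raised by b = length ρ.
-- Next value plus number of entries still present is invariant (b + 1 for ρ alone),
-- so while part of ρ remains the next value is at most b: σ′ is pushed without pops,
-- stays at the bottom of the stack and returns unchanged to the front of the input,
-- and the passes act on the rest of ρ exactly as on ρ alone. In pass t(ρ) + 1 the
-- rest of ρ is output and the stack holding σ′ is popped from with next value b + 1.
-- If the last entry of σ is not 1 nothing pops and σ′ remains; if it is 1, all other
-- entries of σ exceed 1, so this popping is exactly a first pass of σ, raised by b.
-- Raising all values by b commutes with passes, so t(σ) + 1, resp. t(σ), further
-- passes are needed.

open import Defs
open import Data.Bool using (true; false; T)
open import Data.Empty using (⊥-elim)
open import Data.List using (List; []; _∷_; _++_; _∷ʳ_; _ʳ++_; map; length; reverse; head; last; upTo; applyUpTo; initLast; _∷ʳ′_)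
open import Data.List.Properties using (++-identityʳ; ++-conicalˡ; ++-ʳ++; reverse-++; reverse-involutive; length-reverse; length-++; reverse-map)
open import Data.List.Relation.Unary.All as All using (All; []; _∷_)
import Data.List.Relation.Unary.All.Properties as All
open import Data.List.Relation.Binary.Permutation.Propositional using (_↭_; ↭-sym; ↭-trans)
open import Data.List.Relation.Binary.Permutation.Propositional.Properties using (All-resp-↭; drop-∷; ∷↭∷ʳ; ↭-reverse)
open import Data.Maybe using (just)
open import Data.Maybe.Properties using (just-injective)
open import Data.Nat using (ℕ; zero; suc; _+_; _∸_; _≤_; _<_; _≡ᵇ_; z≤n; s≤s; _≤?_)
open import Data.Nat.Properties
open import Data.Product using (_×_; _,_; proj₁; proj₂; map₂)
open import Data.Unit using (tt)
open import Relation.Binary.PropositionalEquality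
open import Relation.Nullary using (¬_; yes; no)

size : ℕ × List ℕ → ℕ
size (n , xs) = n + length xs

popAll-size : ∀ n st → size (popAll n st) ≡ n + length st
popAll-size n []       = refl
popAll-size n (s ∷ st) with s ≡ᵇ n
... | true  = trans (popAll-size (suc n) st) (sym (+-suc n (length st)))
... | false = refl

pushAll-size : ∀ n xs st → size (pushAll n xs st) ≡ n + (length st + length xs)
pushAll-size n []       st = cong (n +_) (sym (+-identityʳ (length st)))
pushAll-size n (x ∷ xs) st = begin
  size (pushAll (proj₁ p) xs (proj₂ p)) ≡⟨ pushAll-size (proj₁ p) xs (proj₂ p) ⟩
  proj₁ p + (length (proj₂ p) + length xs) ≡⟨ +-assoc (proj₁ p) _ _ ⟨
  size p + length xs                      ≡⟨ cong (_+ length xs) (popAll-size n (x ∷ st)) ⟩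
  n + suc (length st) + length xs         ≡⟨ +-assoc n _ _ ⟩
  n + suc (length st + length xs)         ≡⟨ cong (n +_) (+-suc (length st) (length xs)) ⟨
  n + (length st + suc (length xs))       ∎
  where
  open ≡-Reasoning
  p = popAll n (x ∷ st)

onePass-size : ∀ s → size (onePass s) ≡ size s
onePass-size (n , xs) =
  trans (cong (proj₁ p +_) (length-reverse (proj₂ p))) (pushAll-size n xs [])
  where p = pushAll n xs []

passes-size : ∀ j s → size (passes j s) ≡ size s
passes-size zero    s = refl
passes-size (suc j) s = trans (passes-size j (onePass s)) (onePass-size s)

passes-+ : ∀ m n s → passes (m + n) s ≡ passes n (passes m s)
passes-+ zero    n s = refl
passes-+ (suc m) n s = passes-+ m n (onePass s)

passes-suc : ∀ j s → passes (suc j) s ≡ onePass (passes j s)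
passes-suc zero    s = refl
passes-suc (suc j) s = passes-suc j (onePass s)

passes-[] : ∀ j n → passes j (n , []) ≡ (n , [])
passes-[] zero    n = refl
passes-[] (suc j) n = passes-[] j n

passes-sorted : ∀ {j} π → KPassSortable j π → passes j (1 , π) ≡ (suc (length π) , [])
passes-sorted {j} π sorted = cong₂ _,_ next≡ sorted
  where
  s = passes j (1 , π)
  next≡ : proj₁ s ≡ suc (length π)
  next≡ = begin
    proj₁ s                        ≡⟨ +-identityʳ (proj₁ s) ⟨
    proj₁ s + length ([] {A = ℕ})  ≡⟨ cong (λ xs → proj₁ s + length xs) sorted ⟨
    size s                         ≡⟨ passes-size j (1 , π) ⟩
    suc (length π)                 ∎
    where open ≡-Reasoning

pushFrom : ℕ × List ℕ → List ℕ → ℕ × List ℕ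
pushFrom (n , st) xs = pushAll n xs st

popOnto : List ℕ → ℕ × List ℕ → ℕ × List ℕ
popOnto S (n , st) = popAll n (st ++ S)

popAll-++ : ∀ n st S → popAll n (st ++ S) ≡ popOnto S (popAll n st)
popAll-++ n []       S = refl
popAll-++ n (s ∷ st) S with s ≡ᵇ n in s≡ᵇn
... | true  = popAll-++ (suc n) st S
... | false rewrite s≡ᵇn = refl

popAll-head : ∀ n st → head (proj₂ (popAll n st)) ≢ just (proj₁ (popAll n st))
popAll-head n []       ()
popAll-head n (s ∷ st) with s ≡ᵇ n in s≡ᵇn
... | true  = popAll-head (suc n) st
... | false = λ e → subst T s≡ᵇn (≡⇒≡ᵇ s n (just-injective e))

popAll-stuck : ∀ {n st} → head st ≢ just n → popAll n st ≡ (n , st)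
popAll-stuck {n} {[]}     _ = refl
popAll-stuck {n} {s ∷ st} s≢n with s ≡ᵇ n in s≡ᵇn
... | true  = ⊥-elim (s≢n (cong just (≡ᵇ⇒≡ s n (subst T (sym s≡ᵇn) tt))))
... | false = refl

All-<⇒head≢ : ∀ {n S} → All (n <_) S → head S ≢ just n
All-<⇒head≢ []          ()
All-<⇒head≢ (n<s ∷ _) e = <-irrefl (sym (just-injective e)) n<s

pushAll-head : ∀ n xs st → head st ≢ just n → head (proj₂ (pushAll n xs st)) ≢ just (proj₁ (pushAll n xs st))
pushAll-head n []       st h = h
pushAll-head n (x ∷ xs) st _ =
  pushAll-head (proj₁ (popAll n (x ∷ st))) xs (proj₂ (popAll n (x ∷ st))) (popAll-head n (x ∷ st))

pushAll-++ : ∀ n xs ys st → pushAll n (xs ++ ys) st ≡ pushFrom (pushAll n xs st) ys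
pushAll-++ n []       ys st = refl
pushAll-++ n (x ∷ xs) ys st = pushAll-++ (proj₁ (popAll n (x ∷ st))) xs ys (proj₂ (popAll n (x ∷ st)))

pushAll-stuck : ∀ {n xs} st → All (n <_) xs → pushAll n xs st ≡ (n , xs ʳ++ st)
pushAll-stuck st []            = refl
pushAll-stuck {n} {x ∷ xs} st (n<x ∷ n<xs) =
  trans (cong (λ s → pushFrom s xs) (popAll-stuck (All-<⇒head≢ (n<x ∷ []))))
        (pushAll-stuck (x ∷ st) n<xs)

m+1+n≡1+o⇒m≤o : ∀ {m n o} → m + suc n ≡ suc o → m ≤ o
m+1+n≡1+o⇒m≤o {m} eq = ≤-pred (≤-trans (m<m+n m (s≤s z≤n)) (≤-reflexive eq))

-- By the size invariant the next value stays at most b while input remains,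
-- so S is never reached before the input is exhausted.
pushAll-onto : ∀ {b S} → All (b <_) S → ∀ n x xs st → n + (length st + length (x ∷ xs)) ≡ suc b →
  pushAll n (x ∷ xs) (st ++ S) ≡ popOnto S (pushAll n (x ∷ xs) st)
pushAll-onto {S = S} big n x [] st _ =
  cong (λ s → pushFrom s []) (popAll-++ n (x ∷ st) S)
pushAll-onto {b} {S} big n x (y ∷ ys) st inv = begin
  pushAll n (x ∷ y ∷ ys) (st ++ S)
    ≡⟨ cong (λ s → pushFrom s (y ∷ ys)) (popAll-++ n (x ∷ st) S) ⟩
  pushFrom (popOnto S p) (y ∷ ys)
    ≡⟨ cong (λ s → pushFrom s (y ∷ ys)) (popAll-stuck (top-stuck (proj₂ p) (popAll-head n (x ∷ st)) inv′)) ⟩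
  pushAll (proj₁ p) (y ∷ ys) (proj₂ p ++ S)
    ≡⟨ pushAll-onto big (proj₁ p) y ys (proj₂ p) inv′ ⟩
  popOnto S (pushAll n (x ∷ y ∷ ys) st) ∎
  where
  open ≡-Reasoning
  p = popAll n (x ∷ st)
  inv′ : proj₁ p + (length (proj₂ p) + length (y ∷ ys)) ≡ suc b
  inv′ = trans (sym (pushAll-size (proj₁ p) (y ∷ ys) (proj₂ p))) (trans (pushAll-size n (x ∷ y ∷ ys) st) inv)
  top-stuck : ∀ {m} st′ → head st′ ≢ just m → m + (length st′ + length (y ∷ ys)) ≡ suc b → head (st′ ++ S) ≢ just m
  top-stuck []       _ eq = All-<⇒head≢ (All.map (≤-<-trans (m+1+n≡1+o⇒m≤o eq)) big)
  top-stuck (_ ∷ _) h _  = h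

last-∷ʳ : ∀ xs (x : ℕ) → last (xs ∷ʳ x) ≡ just x
last-∷ʳ []           x = refl
last-∷ʳ (_ ∷ [])     x = refl
last-∷ʳ (_ ∷ y ∷ ys) x = last-∷ʳ (y ∷ ys) x

last-++ : ∀ xs {ys : List ℕ} → ys ≢ [] → last (xs ++ ys) ≡ last ys
last-++ xs           {[]}    ys≢[] = ⊥-elim (ys≢[] refl)
last-++ []           {_ ∷ _} _     = refl
last-++ (_ ∷ [])     {_ ∷ _} _     = refl
last-++ (_ ∷ x ∷ xs) {_ ∷ _} ys≢[] = last-++ (x ∷ xs) ys≢[]

head-reverse : ∀ (xs : List ℕ) → head (reverse xs) ≡ last xs
head-reverse xs with initLast xs
... | []        = refl
... | ys ∷ʳ′ y = trans (cong head (++-ʳ++ ys)) (sym (last-∷ʳ ys y))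

last-reverse : ∀ (xs : List ℕ) → last (reverse xs) ≡ head xs
last-reverse xs = trans (sym (head-reverse (reverse xs))) (cong head (reverse-involutive xs))

-- The end of a pass whose stack holds xs (first entry at the bottom):
-- pop as far as possible and return the rest to the input.
drain : ℕ × List ℕ → ℕ × List ℕ
drain (n , xs) = map₂ reverse (popAll n (reverse xs))

drain-last : ∀ {n xs} → last xs ≢ just n → drain (n , xs) ≡ (n , xs)
drain-last {n} {xs} last≢n =
  trans (cong (map₂ reverse) (popAll-stuck (λ e → last≢n (trans (sym (head-reverse xs)) e))))
        (cong (n ,_) (reverse-involutive xs))

onePass-last : ∀ s → last (proj₂ (onePass s)) ≢ just (proj₁ (onePass s))
onePass-last (n , xs) e = pushAll-head n xs [] (λ ()) (trans (sym (last-reverse (proj₂ (pushAll n xs [])))) e)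

onePass-drain : ∀ {n xs} x → All (n <_) xs → onePass (n , xs ∷ʳ x) ≡ drain (n , xs ∷ʳ x)
onePass-drain {n} {xs} x n<xs = cong (map₂ reverse) (begin
  pushAll n (xs ∷ʳ x) []                                 ≡⟨ pushAll-++ n xs (x ∷ []) [] ⟩
  pushFrom (pushAll n xs []) (x ∷ [])
    ≡⟨ cong (λ s → pushFrom s (x ∷ [])) (pushAll-stuck [] n<xs) ⟩
  popAll n (x ∷ reverse xs)                              ≡⟨ cong (popAll n) (++-ʳ++ xs) ⟨
  popAll n (reverse (xs ∷ʳ x))                           ∎)
  where open ≡-Reasoning

input≢[] : ∀ j s → proj₂ (passes j s) ≢ [] → proj₂ s ≢ []
input≢[] j (n , _) unsorted refl = unsorted (cong proj₂ (passes-[] j n))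

-- σ′ is pushed without pops and then lies at the bottom of the stack for the rest of the pass.
onePass-skew : ∀ {b σ′} → All (b <_) σ′ → ∀ n R → R ≢ [] → n + length R ≡ suc b →
  onePass (n , σ′ ++ R) ≡ drain (map₂ (σ′ ++_) (onePass (n , R)))
onePass-skew big n []       R≢[] _   = ⊥-elim (R≢[] refl)
onePass-skew {b} {σ′} big n (x ∷ xs) _ inv = cong (map₂ reverse) (begin
  pushAll n (σ′ ++ x ∷ xs) []                          ≡⟨ pushAll-++ n σ′ (x ∷ xs) [] ⟩
  pushFrom (pushAll n σ′ []) (x ∷ xs)
    ≡⟨ cong (λ s → pushFrom s (x ∷ xs)) (pushAll-stuck [] (All.map (≤-<-trans n≤b) big)) ⟩
  pushAll n (x ∷ xs) (reverse σ′)                      ≡⟨ pushAll-onto (All-resp-↭ (↭-sym (↭-reverse σ′)) big) n x xs [] inv ⟩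
  popAll (proj₁ p) (proj₂ p ++ reverse σ′)
    ≡⟨ cong (λ st → popAll (proj₁ p) (st ++ reverse σ′)) (reverse-involutive (proj₂ p)) ⟨
  popAll (proj₁ p) (reverse (reverse (proj₂ p)) ++ reverse σ′)
    ≡⟨ cong (popAll (proj₁ p)) (reverse-++ σ′ (reverse (proj₂ p))) ⟨
  popAll (proj₁ p) (reverse (σ′ ++ reverse (proj₂ p))) ∎)
  where
  open ≡-Reasoning
  p = pushAll n (x ∷ xs) []
  n≤b : n ≤ b
  n≤b = m+1+n≡1+o⇒m≤o inv

passes-skew : ∀ {b σ′} → All (b <_) σ′ → ∀ j n R → n + length R ≡ suc b →
  proj₂ (passes j (n , R)) ≢ [] → passes j (n , σ′ ++ R) ≡ map₂ (σ′ ++_) (passes j (n , R))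
passes-skew big zero    n R        _   _        = refl
passes-skew big (suc j) n []       _   unsorted = ⊥-elim (input≢[] (suc j) (n , []) unsorted refl)
passes-skew {σ′ = σ′} big (suc j) n (x ∷ xs) inv unsorted = begin
  passes j (onePass (n , σ′ ++ x ∷ xs))  ≡⟨ cong (passes j) (onePass-skew big n (x ∷ xs) (λ ()) inv) ⟩
  passes j (drain (map₂ (σ′ ++_) s))     ≡⟨ cong (passes j) (drain-last last≢next) ⟩
  passes j (map₂ (σ′ ++_) s)             ≡⟨ passes-skew big j (proj₁ s) (proj₂ s) (trans (onePass-size (n , x ∷ xs)) inv) unsorted ⟩
  map₂ (σ′ ++_) (passes j s)             ∎
  where
  open ≡-Reasoning
  s = onePass (n , x ∷ xs)
  last≢next : last (σ′ ++ proj₂ s) ≢ just (proj₁ s)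
  last≢next e = onePass-last (n , x ∷ xs) (trans (sym (last-++ σ′ (input≢[] j s unsorted))) e)

shift : ℕ → ℕ × List ℕ → ℕ × List ℕ
shift b (n , xs) = n + b , map (_+ b) xs

≡ᵇ-+ʳ : ∀ b x n → (x + b ≡ᵇ n + b) ≡ (x ≡ᵇ n)
≡ᵇ-+ʳ b x n rewrite +-comm x b | +-comm n b = ≡ᵇ-+ˡ b
  where
  ≡ᵇ-+ˡ : ∀ b → (b + x ≡ᵇ b + n) ≡ (x ≡ᵇ n)
  ≡ᵇ-+ˡ zero    = refl
  ≡ᵇ-+ˡ (suc b) = ≡ᵇ-+ˡ b

popAll-shift : ∀ b n st → popAll (n + b) (map (_+ b) st) ≡ shift b (popAll n st)
popAll-shift b n []       = refl
popAll-shift b n (s ∷ st) rewrite ≡ᵇ-+ʳ b s n with s ≡ᵇ n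
... | true  = popAll-shift b (suc n) st
... | false = refl

pushAll-shift : ∀ b n xs st → pushAll (n + b) (map (_+ b) xs) (map (_+ b) st) ≡ shift b (pushAll n xs st)
pushAll-shift b n []       st = refl
pushAll-shift b n (x ∷ xs) st =
  trans (cong (λ s → pushFrom s (map (_+ b) xs)) (popAll-shift b n (x ∷ st)))
        (pushAll-shift b (proj₁ (popAll n (x ∷ st))) xs (proj₂ (popAll n (x ∷ st))))

onePass-shift : ∀ b s → onePass (shift b s) ≡ shift b (onePass s)
onePass-shift b (n , xs) =
  trans (cong (map₂ reverse) (pushAll-shift b n xs []))
        (cong (proj₁ p + b ,_) (sym (reverse-map (_+ b) (proj₂ p))))
  where p = pushAll n xs []

passes-shift : ∀ b j s → passes j (shift b s) ≡ shift b (passes j s)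
passes-shift b zero    s = refl
passes-shift b (suc j) s = trans (cong (passes j) (onePass-shift b s)) (passes-shift b j (onePass s))

drain-shift : ∀ b s → drain (shift b s) ≡ shift b (drain s)
drain-shift b (n , xs) = begin
  map₂ reverse (popAll (n + b) (reverse (map (_+ b) xs))) ≡⟨ cong (λ st → map₂ reverse (popAll (n + b) st)) (reverse-map (_+ b) xs) ⟨
  map₂ reverse (popAll (n + b) (map (_+ b) (reverse xs))) ≡⟨ cong (map₂ reverse) (popAll-shift b n (reverse xs)) ⟩
  map₂ reverse (shift b p)                                ≡⟨ cong (proj₁ p + b ,_) (reverse-map (_+ b) (proj₂ p)) ⟨
  shift b (map₂ reverse p)                                ∎
  where
  open ≡-Reasoning
  p = popAll n (reverse xs)

map-≡[] : ∀ {f : ℕ → ℕ} xs → map f xs ≡ [] → xs ≡ []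
map-≡[] [] _ = refl

shifted-above : ∀ b {σ} → All (0 <_) σ → All (b <_) (map (_+ b) σ)
shifted-above b pos = All.map⁺ (All.map (+-monoˡ-< b) pos)

passes-⊖-unsorted : ∀ {σ ρ} j → All (0 <_) σ → proj₂ (passes j (1 , ρ)) ≢ [] →
  passes j (1 , σ ⊖ ρ) ≡ map₂ (map (_+ length ρ) σ ++_) (passes j (1 , ρ))
passes-⊖-unsorted {ρ = ρ} j pos = passes-skew (shifted-above (length ρ) pos) j 1 ρ refl

passes-⊖-after-ρ : ∀ {σ ρ t} → All (0 <_) σ → Tier ρ t → passes (suc t) (1 , σ ⊖ ρ) ≡ shift (length ρ) (drain (1 , σ))
passes-⊖-after-ρ {σ} {ρ} {t} pos (sorted , unsorted) = begin
  passes (suc t) (1 , σ ⊖ ρ)                      ≡⟨ passes-suc t (1 , σ ⊖ ρ) ⟩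
  onePass (passes t (1 , σ ⊖ ρ))                  ≡⟨ cong onePass (passes-⊖-unsorted t pos (unsorted t ≤-refl)) ⟩
  onePass (map₂ (σ′ ++_) (passes t (1 , ρ)))
    ≡⟨ onePass-skew (shifted-above b pos) _ _ (unsorted t ≤-refl) (passes-size t (1 , ρ)) ⟩
  drain (map₂ (σ′ ++_) (onePass (passes t (1 , ρ)))) ≡⟨ cong (λ s → drain (map₂ (σ′ ++_) s)) (passes-suc t (1 , ρ)) ⟨
  drain (map₂ (σ′ ++_) (passes (suc t) (1 , ρ)))   ≡⟨ cong (λ s → drain (map₂ (σ′ ++_) s)) (passes-sorted {suc t} ρ sorted) ⟩
  drain (suc b , σ′ ++ [])                        ≡⟨ cong (λ xs → drain (suc b , xs)) (++-identityʳ σ′) ⟩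
  drain (shift b (1 , σ))                         ≡⟨ drain-shift b (1 , σ) ⟩
  shift b (drain (1 , σ))                         ∎
  where
  open ≡-Reasoning
  b = length ρ
  σ′ = map (_+ b) σ

tier-transfer : ∀ {σ π a c d t} b → Tier σ t → c + d ≡ suc t →
  passes (suc a) (1 , π) ≡ shift b (passes c (1 , σ)) →
  (∀ j → j ≤ a → ¬ KPassSortable j π) → Tier π (a + d)
tier-transfer {σ} {π} {a} {c} {d} {t} b (sortedσ , unsortedσ) c+d≡1+t eq early = sortedπ , unsortedπ
  where
  open ≡-Reasoning
  later : ∀ k → passes (suc a + k) (1 , π) ≡ shift b (passes (c + k) (1 , σ))
  later k = begin
    passes (suc a + k) (1 , π)              ≡⟨ passes-+ (suc a) k (1 , π) ⟩
    passes k (passes (suc a) (1 , π))       ≡⟨ cong (passes k) eq ⟩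
    passes k (shift b (passes c (1 , σ)))   ≡⟨ passes-shift b k (passes c (1 , σ)) ⟩
    shift b (passes k (passes c (1 , σ)))   ≡⟨ cong (shift b) (passes-+ c k (1 , σ)) ⟨
    shift b (passes (c + k) (1 , σ))        ∎
  sortedπ : KPassSortable (suc (a + d)) π
  sortedπ = trans (cong proj₂ (later d)) (cong (map (_+ b)) (subst (λ m → KPassSortable m σ) (sym c+d≡1+t) sortedσ))
  unsortedπ : ∀ j → j < suc (a + d) → ¬ KPassSortable j π
  unsortedπ j j<1+a+d with j ≤? a
  ... | yes j≤a = early j j≤a
  ... | no  j≰a = λ sorted → unsortedσ (c + k) c+k<1+t
          (map-≡[] _ (trans (cong proj₂ (sym (later k))) (subst (λ m → KPassSortable m π) (sym a+1+k≡j) sorted)))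
    where
    k = j ∸ suc a
    a+1+k≡j : suc a + k ≡ j
    a+1+k≡j = m+[n∸m]≡n (≰⇒> j≰a)
    c+k<1+t : c + k < suc t
    c+k<1+t = subst (c + k <_) c+d≡1+t
      (+-monoʳ-< c (+-cancelˡ-< (suc a) k d (subst (_< suc a + d) (sym a+1+k≡j) j<1+a+d)))

IsPerm⇒All-positive : ∀ {σ} → IsPerm σ → All (0 <_) σ
IsPerm⇒All-positive p = All-resp-↭ (↭-sym p) (All.map⁺ (All.universal (λ _ → s≤s z≤n) _))

IsPerm-∷ʳ1⇒All-1< : ∀ τ → IsPerm (τ ∷ʳ 1) → All (1 <_) τ
IsPerm-∷ʳ1⇒All-1< τ p =
  All-resp-↭ (↭-sym τ↭) (All.map⁺ (All.applyUpTo⁺₂ suc (length τ) (λ _ → s≤s (s≤s z≤n))))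
  where
  length-τ∷ʳ1 : length (τ ∷ʳ 1) ≡ suc (length τ)
  length-τ∷ʳ1 = trans (length-++ τ) (+-comm (length τ) 1)
  τ↭ : τ ↭ map suc (applyUpTo suc (length τ))
  τ↭ = drop-∷ (↭-trans (∷↭∷ʳ 1 τ) (subst (λ n → τ ∷ʳ 1 ↭ map suc (upTo n)) length-τ∷ʳ1 p))

drain≡onePass : ∀ {σ} → IsPerm σ → last σ ≡ just 1 → drain (1 , σ) ≡ onePass (1 , σ)
drain≡onePass {σ} p last≡1 with initLast σ
... | []       with () ← last≡1
... | τ ∷ʳ′ x with refl ← trans (sym (last-∷ʳ τ x)) last≡1 = sym (onePass-drain 1 (IsPerm-∷ʳ1⇒All-1< τ p))

proposition3p22 : (σ ρ : List ℕ) → IsPerm σ → IsPerm ρ → σ ≢ [] → ρ ≢ [] →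
    (tσ tρ : ℕ) → Tier σ tσ → Tier ρ tρ →
    (last σ ≢ just 1 →
      KPassSortable (suc tσ + suc tρ) (σ ⊖ ρ) × Tier (σ ⊖ ρ) (tσ + tρ + 1))
    × (last σ ≡ just 1 →
      KPassSortable (tσ + suc tρ) (σ ⊖ ρ) × Tier (σ ⊖ ρ) (tσ + tρ))
proposition3p22 σ ρ pσ _ σ≢[] _ tσ tρ tierσ tierρ = last≢1 , last≡1
  where
  b = length ρ
  π = σ ⊖ ρ
  pos = IsPerm⇒All-positive pσ
  early : ∀ j → j ≤ tρ → ¬ KPassSortable j π
  early j j≤tρ sorted = σ≢[] (map-≡[] σ (++-conicalˡ _ _
    (trans (cong proj₂ (sym (passes-⊖-unsorted j pos (proj₂ tierρ j (s≤s j≤tρ))))) sorted)))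
  last≢1 : last σ ≢ just 1 → KPassSortable (suc tσ + suc tρ) π × Tier π (tσ + tρ + 1)
  last≢1 h = subst (λ m → KPassSortable m π) (+-comm (suc tρ) (suc tσ)) (proj₁ tier)
           , subst (Tier π) (trans (+-comm tρ (suc tσ)) (+-comm 1 (tσ + tρ))) tier
    where
    tier : Tier π (tρ + suc tσ)
    tier = tier-transfer {c = 0} b tierσ refl (trans (passes-⊖-after-ρ pos tierρ) (cong (shift b) (drain-last h))) early
  last≡1 : last σ ≡ just 1 → KPassSortable (tσ + suc tρ) π × Tier π (tσ + tρ)
  last≡1 h = subst (λ m → KPassSortable m π) (sym (+-suc tσ tρ)) (proj₁ tier) , tier
    where
    tier : Tier π (tσ + tρ)
    tier = subst (Tier π) (+-comm tρ tσ)
      (tier-transfer {c = 1} b tierσ refl (trans (passes-⊖-after-ρ pos tierρ) (cong (shift b) (drain≡onePass pσ h))) early)
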